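{- Let $(M,d)$ be a metric space (pseudo-metrics allowed), let $k\ge 1$, and let $s_1,\dots,s_k\in M$ and $a_1,\dots,a_k\in M$ be points such that $s_j=a_j$ for all $j\ge 2$ (only $a_1$ may differ from $s_1$). Let $E_1,\dots,E_k$ be arbitrary real numbers. Define, for $x,y,z\in M$, $\alpha_{\{x\},\{y,z\}}=\tfrac12\bigl(d(x,y)+d(x,z)-d(y,z)\bigr)$, and $$\mathcal D=\sum_{1\le i<j\le k} d(s_i,s_j),\qquad \mathcal M=k\sum_{i=1}^k d(a_i,s_i),$$ $$\varepsilon^i_j=\alpha_{\{s_j\},\{a_j,s_i\}},\quad \varepsilon^i=\sum_{j=1}^k\varepsilon^i_j,\quad e_i=E_i-\varepsilon^i,\quad e_{\max}=\max_{1\le i\le k}e_i,$$ $$\mathcal H=2\sum_{i=1}^k\bigl(e_{\max}-E_i\bigr),\qquad \Phi=\mathcal D+\mathcal M+\mathcal H.$$ Then $\Phi\ge 0$.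
   Context: This is the "Teia potential" used to analyze the HANDICAP algorithm for the $k$-server problem: $s_1,\dots,s_k$ are the positions of the algorithm's servers, $a_1,\dots,a_k$ the positions of the adversary's servers, indexed so that $s_i$ is paired with $a_i$, and $E_i$ is the handicap of the $i$-th algorithm server. The quantity $\alpha_{\{x\},\{y,z\}}$ is the isolation index of the pair $\{\{x\},\{y,z\}\}$ and is always nonnegative. -}

module Defs where

open import Level using (Level; _⊔_) renaming (suc to lsuc)
open import Data.Nat using (ℕ; zero; suc)
open import Data.Fin using (Fin; zero; suc; toℕ; inject)
open import Data.Sum using (_⊎_; inj₁; inj₂)
open import Data.Product using (∃)
open import Relation.Nullary using (¬_)
open import Algebra.Bundles using (CommutativeRing)

record OrderedField c ℓ₁ ℓ₂ : Set (lsuc (c ⊔ ℓ₁ ⊔ ℓ₂)) where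
  field
    commRing : CommutativeRing c ℓ₁
  open CommutativeRing commRing public
  field
    _≤_        : Carrier → Carrier → Set ℓ₂
    ≤-refl     : ∀ {x} → x ≤ x
    ≤-trans    : ∀ {x y z} → x ≤ y → y ≤ z → x ≤ z
    ≤-antisym  : ∀ {x y} → x ≤ y → y ≤ x → x ≈ y
    ≤-resp-≈   : ∀ {x x′ y y′} → x ≈ x′ → y ≈ y′ → x ≤ y → x′ ≤ y′
    ≤-total    : ∀ x y → (x ≤ y) ⊎ (y ≤ x)
    +-mono-≤   : ∀ {x y} z → x ≤ y → (x + z) ≤ (y + z)
    *-nonneg   : ∀ {x y} → 0# ≤ x → 0# ≤ y → 0# ≤ (x * y)
    0≉1        : ¬ (0# ≈ 1#)
    inverse    : ∀ x → ¬ (x ≈ 0#) → ∃ λ y → (x * y) ≈ 1#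

  max : Carrier → Carrier → Carrier
  max x y with ≤-total x y
  ... | inj₁ _ = y
  ... | inj₂ _ = x

record PseudoMetricSpace {c ℓ₁ ℓ₂} (F : OrderedField c ℓ₁ ℓ₂) (m : Level)
       : Set (lsuc m ⊔ c ⊔ ℓ₁ ⊔ ℓ₂) where
  open OrderedField F using (Carrier; _≈_; _≤_; _+_; 0#)
  field
    Point    : Set m
    d        : Point → Point → Carrier
    d-refl   : ∀ x → d x x ≈ 0#
    d-sym    : ∀ x y → d x y ≈ d y x
    d-tri    : ∀ x y z → d x z ≤ (d x y + d y z)

module _ {c ℓ₁ ℓ₂} (F : OrderedField c ℓ₁ ℓ₂) where
  open OrderedField F using (Carrier; _+_; 0#; 1#; max)

  -- 1/2, characterised as the (unique) element with ½ + ½ ≈ 1 (exists since 1+1 ≠ 0).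
  -- We take it as an explicit argument below rather than choosing it.

  sumFin : ∀ {n} → (Fin n → Carrier) → Carrier
  sumFin {zero}  f = 0#
  sumFin {suc n} f = f zero + sumFin (λ i → f (suc i))

  fromℕ : ℕ → Carrier
  fromℕ zero    = 0#
  fromℕ (suc n) = 1# + fromℕ n

  maxFin : ∀ {n} → (Fin (suc n) → Carrier) → Carrier
  maxFin {zero}  f = f zero
  maxFin {suc n} f = max (f zero) (maxFin (λ i → f (suc i)))

module Teia {c ℓ₁ ℓ₂ m} {F : OrderedField c ℓ₁ ℓ₂} (X : PseudoMetricSpace F m)
            (half : OrderedField.Carrier F)
            where
  open OrderedField F using (Carrier; _+_; _*_; _-_; 1#)
  open PseudoMetricSpace X

  α : Point → Point → Point → Carrier
  α x y z = half * ((d x y + d x z) - d y z)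

  module _ (k : ℕ) (s a : Fin k → Point) (E : Fin k → Carrier) where
    -- D = ∑_{i<j} d(s_i, s_j)
    𝒟 : Carrier
    𝒟 = sumFin F (λ j → sumFin F (λ (i : Fin (toℕ j)) → d (s (inject i)) (s j)))

    ℳ : Carrier
    ℳ = fromℕ F k * sumFin F (λ i → d (a i) (s i))

    ε : Fin k → Carrier
    ε i = sumFin F (λ j → α (s j) (a j) (s i))

    e : Fin k → Carrier
    e i = E i - ε i

  module _ (n : ℕ) (s a : Fin (suc n) → Point) (E : Fin (suc n) → Carrier) where
    emax : Carrier
    emax = maxFin F (e (suc n) s a E)

    ℋ : Carrier
    ℋ = (1# + 1#) * sumFin F (λ i → emax - E i)

    Φ : Carrier
    Φ = (𝒟 (suc n) s a E + ℳ (suc n) s a E) + ℋ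

{-# OPTIONS --safe #-}

-- Since aⱼ = sⱼ for j ≥ 2, each εⁱ reduces to its first term α_{{s₁},{a₁,sᵢ}} and ℳ to
-- k·d(a₁,s₁). As e_max ≥ eᵢ, the i-th summand of ℋ satisfies
--   2(e_max − Eᵢ) ≥ −2εⁱ = d(a₁,sᵢ) − d(s₁,a₁) − d(s₁,sᵢ),
-- so 2(e_max − Eᵢ) + d(a₁,s₁) + d(s₁,sᵢ) ≥ d(a₁,sᵢ) ≥ 0. Summing over i gives
-- ℋ + ℳ + ∑ᵢ d(s₁,sᵢ) ≥ 0, and ∑ᵢ d(s₁,sᵢ) is the part of 𝒟 made of the pairs containing s₁.
module Submission where

open import Defs
open import Data.Nat using (ℕ; suc)
open import Data.Fin using (Fin; zero; suc; toℕ; inject)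
open import Relation.Binary.PropositionalEquality using (_≡_; _≢_)
open import Data.Sum using (inj₁; inj₂)
open import Data.Maybe using (nothing)
import Relation.Binary.PropositionalEquality as ≡
open import Relation.Binary.Bundles using (Preorder)
open import Relation.Binary.Structures using (IsPreorder)
open import Tactic.RingSolver.Core.AlmostCommutativeRing using (fromCommutativeRing)
import Tactic.RingSolver.NonReflective as RingSolver
import Relation.Binary.Reasoning.Preorder as PreorderReasoning
import Relation.Binary.Reasoning.Setoid as SetoidReasoning

module OrderedFieldProperties {c ℓ₁ ℓ₂} (F : OrderedField c ℓ₁ ℓ₂) where
  open OrderedField F hiding (zero; +-mono-≤)
  open OrderedField F public using () renaming (+-mono-≤ to +-monoˡ-≤)
  open RingSolver (fromCommutativeRing commRing (λ _ → nothing)) public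
    using (solve; _⊜_; _⊕_; ⊝_)
  open import Algebra.Properties.AbelianGroup +-abelianGroup using (⁻¹-anti-homo‿-)

  ≤-isPreorder : IsPreorder _≈_ _≤_
  ≤-isPreorder = record
    { isEquivalence = isEquivalence
    ; reflexive     = λ x≈y → ≤-resp-≈ refl x≈y ≤-refl
    ; trans         = ≤-trans
    }

  ≤-preorder : Preorder c ℓ₁ ℓ₂
  ≤-preorder = record { isPreorder = ≤-isPreorder }

  open IsPreorder ≤-isPreorder public
    using (≲-respˡ-≈; ≲-respʳ-≈) renaming (reflexive to ≤-reflexive)

  +-monoʳ-≤ : ∀ z {x y} → x ≤ y → (z + x) ≤ (z + y)
  +-monoʳ-≤ z {x} {y} x≤y = ≤-resp-≈ (+-comm x z) (+-comm y z) (+-monoˡ-≤ z x≤y)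

  +-mono-≤ : ∀ {x y u v} → x ≤ y → u ≤ v → (x + u) ≤ (y + v)
  +-mono-≤ {y = y} {u} x≤y u≤v = ≤-trans (+-monoˡ-≤ u x≤y) (+-monoʳ-≤ y u≤v)

  +-nonneg : ∀ {x y} → 0# ≤ x → 0# ≤ y → 0# ≤ (x + y)
  +-nonneg 0≤x 0≤y = ≲-respˡ-≈ (+-identityʳ 0#) (+-mono-≤ 0≤x 0≤y)

  x≤y⇒0≤y-x : ∀ {x y} → x ≤ y → 0# ≤ (y - x)
  x≤y⇒0≤y-x {x} x≤y = ≲-respˡ-≈ (-‿inverseʳ x) (+-monoˡ-≤ (- x) x≤y)

  0≤x+x⇒0≤x : ∀ x → 0# ≤ (x + x) → 0# ≤ x
  0≤x+x⇒0≤x x 0≤x+x with ≤-total 0# x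
  ... | inj₁ 0≤x = 0≤x
  ... | inj₂ x≤0 = ≤-trans 0≤x+x (≲-respʳ-≈ (+-identityˡ x) (+-monoˡ-≤ x x≤0))

  x≤max[x,y] : ∀ x y → x ≤ max x y
  x≤max[x,y] x y with ≤-total x y
  ... | inj₁ x≤y = x≤y
  ... | inj₂ _   = ≤-refl

  y≤max[x,y] : ∀ x y → y ≤ max x y
  y≤max[x,y] x y with ≤-total x y
  ... | inj₁ _   = ≤-refl
  ... | inj₂ y≤x = y≤x

  f≤maxFin[f] : ∀ {n} (f : Fin (suc n) → Carrier) i → f i ≤ maxFin F f
  f≤maxFin[f] {ℕ.zero} f zero    = ≤-refl
  f≤maxFin[f] {suc n}  f zero    = x≤max[x,y] _ _
  f≤maxFin[f] {suc n}  f (suc i) =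
    ≤-trans (f≤maxFin[f] (λ j → f (suc j)) i) (y≤max[x,y] _ _)

  sumFin-mono : ∀ {n} {f g : Fin n → Carrier} → (∀ i → f i ≤ g i) → sumFin F f ≤ sumFin F g
  sumFin-mono {ℕ.zero} f≤g = ≤-refl
  sumFin-mono {suc n}  f≤g = +-mono-≤ (f≤g zero) (sumFin-mono (λ i → f≤g (suc i)))

  sumFin-nonneg : ∀ {n} {f : Fin n → Carrier} → (∀ i → 0# ≤ f i) → 0# ≤ sumFin F f
  sumFin-nonneg {ℕ.zero} 0≤f = ≤-refl
  sumFin-nonneg {suc n}  0≤f = +-nonneg (0≤f zero) (sumFin-nonneg (λ i → 0≤f (suc i)))

  sumFin-≈0 : ∀ {n} {f : Fin n → Carrier} → (∀ i → f i ≈ 0#) → sumFin F f ≈ 0#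
  sumFin-≈0 {ℕ.zero} f≈0 = refl
  sumFin-≈0 {suc n}  f≈0 =
    trans (+-cong (f≈0 zero) (sumFin-≈0 (λ i → f≈0 (suc i)))) (+-identityʳ 0#)

  sumFin-+ : ∀ {n} (f g : Fin n → Carrier) →
             sumFin F (λ i → f i + g i) ≈ sumFin F f + sumFin F g
  sumFin-+ {ℕ.zero} f g = sym (+-identityʳ 0#)
  sumFin-+ {suc n}  f g = trans (+-congˡ (sumFin-+ (λ i → f (suc i)) (λ i → g (suc i))))
    (solve 4 (λ x y u v → ((x ⊕ y) ⊕ (u ⊕ v)) ⊜ ((x ⊕ u) ⊕ (y ⊕ v))) refl
       (f zero) (g zero) (sumFin F (λ i → f (suc i))) (sumFin F (λ i → g (suc i))))

  sumFin-const : ∀ n x → sumFin F {n} (λ _ → x) ≈ fromℕ F n * x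
  sumFin-const ℕ.zero  x = sym (zeroˡ x)
  sumFin-const (suc n) x = trans (+-cong (sym (*-identityˡ x)) (sumFin-const n x))
    (sym (distribʳ x 1# (fromℕ F n)))

  x≤x+y : ∀ {x y} → 0# ≤ y → x ≤ (x + y)
  x≤x+y {x} 0≤y = ≲-respˡ-≈ (+-identityʳ x) (+-monoʳ-≤ x 0≤y)

  x-[y-z]≈[x-y]+z : ∀ x y z → x - (y - z) ≈ (x - y) + z
  x-[y-z]≈[x-y]+z x y z = trans (+-congˡ (⁻¹-anti-homo‿- y z))
    (solve 3 (λ x y z → (x ⊕ (z ⊕ (⊝ y))) ⊜ ((x ⊕ (⊝ y)) ⊕ z)) refl x y z)

  [1+1]*x≈x+x : ∀ x → (1# + 1#) * x ≈ x + x
  [1+1]*x≈x+x x = trans (distribʳ x 1# 1#) (+-cong (*-identityˡ x) (*-identityˡ x))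

  half*x+half*x≈x : ∀ {half} → half + half ≈ 1# → ∀ x → half * x + half * x ≈ x
  half*x+half*x≈x {half} half+half≈1 x =
    trans (sym (distribʳ x half half)) (trans (*-congʳ half+half≈1) (*-identityˡ x))

module PseudoMetricProperties {c ℓ₁ ℓ₂ m} {F : OrderedField c ℓ₁ ℓ₂}
                              (X : PseudoMetricSpace F m) where
  open OrderedField F hiding (zero; +-mono-≤)
  open OrderedFieldProperties F
  open PseudoMetricSpace X

  d-nonneg : ∀ x y → 0# ≤ d x y
  d-nonneg x y =
    0≤x+x⇒0≤x (d x y) (≤-resp-≈ (d-refl x) (+-congˡ (d-sym y x)) (d-tri x y x))

  ≡⇒d≈0 : ∀ {x y} → x ≡ y → d x y ≈ 0#
  ≡⇒d≈0 {x} ≡.refl = d-refl x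

  module _ (half : Carrier) where
    open Teia X half

    ≡⇒α≈0 : ∀ {x y} z → x ≡ y → α x y z ≈ 0#
    ≡⇒α≈0 {x} z ≡.refl = begin
      half * ((d x x + d x z) - d x z) ≈⟨ *-congˡ (+-congʳ (+-congʳ (d-refl x))) ⟩
      half * ((0# + d x z) - d x z)    ≈⟨ *-congˡ (+-congʳ (+-identityˡ (d x z))) ⟩
      half * (d x z - d x z)           ≈⟨ *-congˡ (-‿inverseʳ (d x z)) ⟩
      half * 0#                        ≈⟨ zeroʳ half ⟩
      0#                               ∎
      where open SetoidReasoning setoid

    α+α≈d+d-d : half + half ≈ 1# → ∀ x y z → α x y z + α x y z ≈ (d x y + d x z) - d y z
    α+α≈d+d-d half+half≈1 x y z = half*x+half*x≈x half+half≈1 _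

    ∑d[s₀,s]≤𝒟 : ∀ n (s a : Fin (suc n) → Point) E →
                 sumFin F (λ i → d (s zero) (s i)) ≤ 𝒟 (suc n) s a E
    ∑d[s₀,s]≤𝒟 n s a E = +-mono-≤ (≤-reflexive (d-refl (s zero))) (sumFin-mono first≤row)
      where
      first≤row : ∀ j → d (s zero) (s (suc j))
                        ≤ sumFin F (λ (i : Fin (toℕ (suc j))) → d (s (inject i)) (s (suc j)))
      first≤row j = x≤x+y (sumFin-nonneg {toℕ j} (λ i → d-nonneg (s (inject (suc i))) (s (suc j))))

module SingleMismatch {c ℓ₁ ℓ₂ m} {F : OrderedField c ℓ₁ ℓ₂} (X : PseudoMetricSpace F m)
    (half : OrderedField.Carrier F)
    (half+half≈1 : OrderedField._≈_ F (OrderedField._+_ F half half) (OrderedField.1# F))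
    (n : ℕ) (s a : Fin (suc n) → PseudoMetricSpace.Point X)
    (E : Fin (suc n) → OrderedField.Carrier F)
    (s≡a : ∀ j → j ≢ zero → s j ≡ a j) where
  open OrderedField F hiding (zero; +-mono-≤)
  open OrderedFieldProperties F
  open PseudoMetricSpace X
  open PseudoMetricProperties X
  open Teia X half
  open import Algebra.Properties.AbelianGroup +-abelianGroup using (//-rightDividesˡ)

  δ : Carrier
  δ = d (a zero) (s zero)

  slack : Fin (suc n) → Carrier
  slack i = emax n s a E - E i

  summand : Fin (suc n) → Carrier
  summand i = ((slack i + slack i) + δ) + d (s zero) (s i)

  s∘suc≡a∘suc : ∀ j → s (suc j) ≡ a (suc j)
  s∘suc≡a∘suc j = s≡a (suc j) (λ ())

  ε≈α₀ : ∀ i → ε (suc n) s a E i ≈ α (s zero) (a zero) (s i)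
  ε≈α₀ i = trans (+-congˡ (sumFin-≈0 (λ j → ≡⇒α≈0 half (s i) (s∘suc≡a∘suc j))))
                 (+-identityʳ _)

  ℳ≈k*δ : ℳ (suc n) s a E ≈ fromℕ F (suc n) * δ
  ℳ≈k*δ = *-congˡ (trans (+-congˡ (sumFin-≈0 (λ j → ≡⇒d≈0 (≡.sym (s∘suc≡a∘suc j)))))
                         (+-identityʳ δ))

  -- 2(e_max − eᵢ) + d(a₁,sᵢ) ≥ 0 is the i-th summand in disguise.
  summand-nonneg : ∀ i → 0# ≤ summand i
  summand-nonneg i = begin
    0#
      ≲⟨ +-nonneg (+-nonneg 0≤gap 0≤gap) (d-nonneg (a zero) (s i)) ⟩
    ((M - eᵢ) + (M - eᵢ)) + q
      ≈⟨ +-congʳ (+-cong unfold-e unfold-e) ⟩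
    ((slack i + εᵢ) + (slack i + εᵢ)) + q
      ≈⟨ solve 3 (λ x y z → (((x ⊕ y) ⊕ (x ⊕ y)) ⊕ z) ⊜ ((x ⊕ x) ⊕ ((y ⊕ y) ⊕ z)))
               refl (slack i) εᵢ q ⟩
    (slack i + slack i) + ((εᵢ + εᵢ) + q)
      ≈⟨ +-congˡ (+-congʳ εᵢ+εᵢ≈d+d-d) ⟩
    (slack i + slack i) + ((δ′ + p - q) + q)
      ≈⟨ +-congˡ (//-rightDividesˡ q (δ′ + p)) ⟩
    (slack i + slack i) + (δ′ + p)
      ≈⟨ sym (+-assoc _ δ′ p) ⟩
    ((slack i + slack i) + δ′) + p
      ≈⟨ +-congʳ (+-congˡ (d-sym (s zero) (a zero))) ⟩
    summand i
      ∎
    where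
    open PreorderReasoning ≤-preorder
    M  = emax n s a E
    eᵢ = e (suc n) s a E i
    εᵢ = ε (suc n) s a E i
    δ′ = d (s zero) (a zero)
    p  = d (s zero) (s i)
    q  = d (a zero) (s i)
    0≤gap : 0# ≤ (M - eᵢ)
    0≤gap = x≤y⇒0≤y-x (f≤maxFin[f] (e (suc n) s a E) i)
    unfold-e : M - eᵢ ≈ slack i + εᵢ
    unfold-e = x-[y-z]≈[x-y]+z M (E i) εᵢ
    εᵢ+εᵢ≈d+d-d : εᵢ + εᵢ ≈ δ′ + p - q
    εᵢ+εᵢ≈d+d-d = trans (+-cong (ε≈α₀ i) (ε≈α₀ i)) (α+α≈d+d-d half half+half≈1 _ _ _)

  sumFin-summand : sumFin F summand
                   ≈ (ℋ n s a E + ℳ (suc n) s a E) + sumFin F (λ i → d (s zero) (s i))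
  sumFin-summand = begin
    sumFin F summand
      ≈⟨ sumFin-+ (λ i → (slack i + slack i) + δ) (λ i → d (s zero) (s i)) ⟩
    sumFin F (λ i → (slack i + slack i) + δ) + ∑p
      ≈⟨ +-congʳ (sumFin-+ (λ i → slack i + slack i) (λ _ → δ)) ⟩
    (sumFin F (λ i → slack i + slack i) + sumFin F {suc n} (λ _ → δ)) + ∑p
      ≈⟨ +-congʳ (+-cong (sumFin-+ slack slack) (sumFin-const (suc n) δ)) ⟩
    ((sumFin F slack + sumFin F slack) + fromℕ F (suc n) * δ) + ∑p
      ≈⟨ +-congʳ (+-cong (sym ([1+1]*x≈x+x _)) (sym ℳ≈k*δ)) ⟩
    (ℋ n s a E + ℳ (suc n) s a E) + ∑p
      ∎
    where
    open SetoidReasoning setoid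
    ∑p = sumFin F (λ i → d (s zero) (s i))

lemma2 : ∀ {c ℓ₁ ℓ₂ m} (F : OrderedField c ℓ₁ ℓ₂) (X : PseudoMetricSpace F m)
    (half : OrderedField.Carrier F)
    → OrderedField._≈_ F (OrderedField._+_ F half half) (OrderedField.1# F)
    → (n : ℕ) (s a : Fin (suc n) → PseudoMetricSpace.Point X)
    → (E : Fin (suc n) → OrderedField.Carrier F)
    → (∀ j → j ≢ zero → s j ≡ a j)
    → OrderedField._≤_ F (OrderedField.0# F) (Teia.Φ X half n s a E)
lemma2 F X half half+half≈1 n s a E s≡a = begin
  0#                     ≲⟨ sumFin-nonneg summand-nonneg ⟩
  sumFin F summand       ≈⟨ sumFin-summand ⟩
  (ℋ' + ℳ') + ∑p         ≈⟨ solve 3 (λ x y z → ((x ⊕ y) ⊕ z) ⊜ ((z ⊕ y) ⊕ x)) refl ℋ' ℳ' ∑p ⟩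
  (∑p + ℳ') + ℋ'         ≲⟨ +-monoˡ-≤ ℋ' (+-monoˡ-≤ ℳ' (∑d[s₀,s]≤𝒟 half n s a E)) ⟩
  Teia.Φ X half n s a E  ∎
  where
  open OrderedField F hiding (zero; +-mono-≤)
  open OrderedFieldProperties F
  open PseudoMetricSpace X
  open PseudoMetricProperties X
  open Teia X half
  open SingleMismatch X half half+half≈1 n s a E s≡a
  open PreorderReasoning ≤-preorder
  ℋ' = ℋ n s a E
  ℳ' = ℳ (suc n) s a E
  ∑p = sumFin F (λ i → d (s zero) (s i))
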